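{- Let $W$ be the group with generators $r_0,\ldots,r_{n-1}$ and relations $r_i^2=(r_ir_j)^2=\epsilon$ for $0\le i<j-1\le n-2$, and $W^+=\langle s_1,\dots,s_{n-1}\rangle$ with $s_i=r_{i-1}r_i$. Let $\mathcal P$ be a chiral $n$-polytope and $M$ the normal subgroup of $W^+$ with $\Gamma(\mathcal P)=\Gamma^+(\mathcal P)= W^+/M$ (via $s_i M\mapsto\sigma_i$). If $\mathcal{P}$ is totally chiral, then \[ W^{+}/M_{W} \;\cong\; \Gamma^{+}(\mathcal{P}) \times \Gamma^{+}(\mathcal{P}) = \Gamma(\mathcal{P}) \times \Gamma(\mathcal{P}), \] where $M_W=M\cap r_0Mr_0^{ -1}$.
   Context: For a chiral $n$-polytope $\mathcal P$, $\Gamma(\mathcal P)$ is generated by distinguished rotations $\sigma_1,\dots,\sigma_{n-1}$ with respect to a base flag, which satisfy $(\sigma_i\cdots\sigma_j)^2=\epsilon$ for $i<j$; hence $\Gamma(\mathcal P)$ is a quotient $W^+/M$ of $W^+$ via $s_i\mapsto \sigma_i$, and one sets $\Gamma^+(\mathcal P):=\Gamma(\mathcal P)$. With $M^{r_0}=r_0Mr_0^{ -1}$ and $M^W=MM^{r_0}$, the chirality group is $X(\mathcal P)=M^W/M$ (a normal subgroup of $W^+/M$), and $\mathcal P$ is totally chiral if $X(\mathcal P)=\Gamma^+(\mathcal P)$, i.e. $M^W=W^+$. -}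

module Defs where

open import Data.Nat using (ℕ; zero; suc; _+_; _≤_)
open import Data.Fin using (Fin; zero; suc; toℕ; inject₁)
open import Data.Fin.Subset using (Subset; _∈_; _∩_)
open import Data.Bool using (Bool; true; false; not)
open import Data.List using (List; []; _∷_; _++_; [_]; reverse; map; concatMap)
open import Data.Product using (Σ; ∃; ∃₂; _×_; _,_; proj₁; proj₂)
open import Relation.Nullary using (¬_)
open import Relation.Unary using (Pred)
open import Relation.Binary.Construct.Closure.Equivalence using (EqClosure)
open import Level using (0ℓ)
open import Function.Bundles using (_⇔_)

-- The Coxeter group W of rank n (string diagram, no further relations):
-- generators r_0 , … , r_{n-1}, relations r_i² = ε and (r_i r_j)² = ε
-- for 0 ≤ i < j-1 ≤ n-2.  Elements are words in the r_i (List (Fin n));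
-- equality is the congruence generated by deleting a relator.

data Relator {n : ℕ} : List (Fin n) → Set where
  invol : (i : Fin n) → Relator (i ∷ i ∷ [])
  comm  : (i j : Fin n) → suc (suc (toℕ i)) ≤ toℕ j →
          Relator (i ∷ j ∷ i ∷ j ∷ [])

data Step {n : ℕ} : List (Fin n) → List (Fin n) → Set where
  del : (u v rel : List (Fin n)) → Relator rel → Step (u ++ rel ++ v) (u ++ v)

_≈W_ : {n : ℕ} → List (Fin n) → List (Fin n) → Set
_≈W_ {n} = EqClosure (Step {n})

-- Here n = suc m, and the letter (k , b) with k : Fin m stands for
-- s_{k+1} (b = true) or its inverse s_{k+1}⁻¹ (b = false).

SLetter : ℕ → Set
SLetter m = Fin m × Bool

W⁺ : ℕ → Set
W⁺ m = List (SLetter m)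

ιL : {m : ℕ} → SLetter m → List (Fin (suc m))
ιL (k , true)  = inject₁ k ∷ suc k ∷ []
ιL (k , false) = suc k ∷ inject₁ k ∷ []

ι : {m : ℕ} → W⁺ m → List (Fin (suc m))
ι = concatMap ιL

_≈⁺_ : {m : ℕ} → W⁺ m → W⁺ m → Set
x ≈⁺ y = ι x ≈W ι y

-- group operations in W⁺: product is concatenation, ε is [], inverse:
inv : {m : ℕ} → W⁺ m → W⁺ m
inv x = reverse (map (λ { (k , b) → (k , not b) }) x)

record IsNormalSubgroup {m : ℕ} (N : Pred (W⁺ m) 0ℓ) : Set where
  field
    resp    : ∀ {x y} → x ≈⁺ y → N x → N y
    ε-mem   : N []
    ∙-mem   : ∀ {x y} → N x → N y → N (x ++ y)
    inv-mem : ∀ {x} → N x → N (inv x)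
    conj    : ∀ {x} (g : W⁺ m) → N x → N ((g ++ x) ++ inv g)

_∼[_]_ : {m : ℕ} → W⁺ m → Pred (W⁺ m) 0ℓ → W⁺ m → Set
x ∼[ N ] y = N (inv x ++ y)

r₀ : {m : ℕ} → Fin (suc m)
r₀ = zero

-- M^{r₀} = r₀ M r₀⁻¹  (r₀⁻¹ = r₀), as a subgroup of W⁺
_^r₀ : {m : ℕ} → Pred (W⁺ m) 0ℓ → Pred (W⁺ m) 0ℓ
(M ^r₀) g = ∃ λ h → M h × (ι g ≈W ((r₀ ∷ ι h) ++ (r₀ ∷ [])))

core : {m : ℕ} → Pred (W⁺ m) 0ℓ → Pred (W⁺ m) 0ℓ
core M g = M g × (M ^r₀) g

-- total chirality: M^W = M M^{r₀} = W⁺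
TotallyChiral : {m : ℕ} → Pred (W⁺ m) 0ℓ → Set
TotallyChiral {m} M =
  (g : W⁺ m) → ∃₂ λ a b → M a × (M ^r₀) b × (g ≈⁺ (a ++ b))

-- Chiral polytope with rotation group Γ = W⁺/M  (Schulte–Weiss group
-- characterisation).  τ_{i,j} is the image of r_i r_j (= σ_{i+1}⋯σ_j for
-- i < j).  Γ_I = ⟨ τ_{i,j} : i , j ∈ I ⟩ for I ⊆ {0,…,n-1}.

PairWord : {n : ℕ} → Subset n → Set
PairWord {n} I = List (Σ (Fin n × Fin n) λ p → proj₁ p ∈ I × proj₂ p ∈ I)

evalPairs : {n : ℕ} {I : Subset n} → PairWord I → List (Fin n)
evalPairs = concatMap (λ { ((i , j) , _) → i ∷ j ∷ [] })

InΓ : {m : ℕ} → Pred (W⁺ m) 0ℓ → Subset (suc m) → W⁺ m → Set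
InΓ {m} M I g = ∃ λ (h : W⁺ m) → (g ∼[ M ] h) ×
                  ∃ λ (w : PairWord I) → ι h ≈W evalPairs w

IntersectionCondition : {m : ℕ} → Pred (W⁺ m) 0ℓ → Set
IntersectionCondition {m} M = (I J : Subset (suc m)) (g : W⁺ m) →
  (InΓ M I g × InΓ M J g) ⇔ InΓ M (I ∩ J) g

-- P is regular iff M = M^{r₀}; chiral = not regular.
IsChiralPolytopeGroup : {m : ℕ} → Pred (W⁺ m) 0ℓ → Set
IsChiralPolytopeGroup {m} M =
  IsNormalSubgroup M × IntersectionCondition M ×
  ¬ ((g : W⁺ m) → M g ⇔ (M ^r₀) g)

record QuotIso {m : ℕ} (N K L : Pred (W⁺ m) 0ℓ) : Set where
  field
    f₁ f₂ : W⁺ m → W⁺ m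
    well-def : ∀ x y → x ∼[ N ] y → (f₁ x ∼[ K ] f₁ y) × (f₂ x ∼[ L ] f₂ y)
    hom      : ∀ x y → (f₁ (x ++ y) ∼[ K ] (f₁ x ++ f₁ y))
                     × (f₂ (x ++ y) ∼[ L ] (f₂ x ++ f₂ y))
    injective : ∀ x y → (f₁ x ∼[ K ] f₁ y) × (f₂ x ∼[ L ] f₂ y) → x ∼[ N ] y
    surjective : ∀ a b → ∃ λ x → (f₁ x ∼[ K ] a) × (f₂ x ∼[ L ] b)

{-# OPTIONS --safe #-}
-- Conjugation by r₀ restricts to an automorphism conj⁺ of W⁺, given by a substitution
-- on the generators s_i, and M^{r₀} is the preimage of M under it.  Hence
-- x ↦ (xM , conj⁺(x)M) has kernel M ∩ M^{r₀} = M_W, and, as in the Chinese remainder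
-- theorem, it is onto because M M^{r₀} = W⁺.
module Submission where

open import Defs
open import Data.Nat using (ℕ; suc; z≤n; s≤s)
open import Data.Fin using (Fin; zero; suc; inject₁)
open import Data.Bool using (true; false; not)
open import Data.List using (List; []; _∷_; _++_; [_]; reverse; map; concatMap)
open import Data.List.Properties
  using (++-assoc; ++-identityʳ; concatMap-++; map-++; reverse-++; reverse-involutive)
open import Data.Product using (∃; _×_; _,_; map₂)
open import Function using (id)
open import Function.Bundles using (_⇔_; mk⇔; Equivalence)
open import Level using (0ℓ)
open import Relation.Binary.Bundles using (Setoid)
import Relation.Binary.Construct.Closure.Equivalence as EqClosure
import Relation.Binary.Construct.On as On
open import Relation.Binary.PropositionalEquality
  using (_≡_; refl; sym; trans; cong; cong₂; subst; subst₂; module ≡-Reasoning)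
import Relation.Binary.Reasoning.Setoid as SetoidReasoning
open import Relation.Unary using (Pred)

private
  variable
    m n : ℕ

≈W-setoid : ℕ → Setoid 0ℓ 0ℓ
≈W-setoid n = EqClosure.setoid (Step {n})

-- x ≈⁺ y unfolds to ι x ≈W ι y, from which Agda cannot recover x and y; this is why
-- the words are passed explicitly to several lemmas about ≈⁺ below.
≈⁺-setoid : ℕ → Setoid 0ℓ 0ℓ
≈⁺-setoid m = record
  { _≈_           = _≈⁺_ {m}
  ; isEquivalence = On.isEquivalence ι (EqClosure.isEquivalence Step)
  }

module ≈W-Reasoning {n : ℕ} = SetoidReasoning (≈W-setoid n)
module ≈⁺-Reasoning {m : ℕ} = SetoidReasoning (≈⁺-setoid m)

≈W-refl : {x : List (Fin n)} → x ≈W x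
≈W-refl = EqClosure.reflexive Step

≈W-sym : {x y : List (Fin n)} → x ≈W y → y ≈W x
≈W-sym = EqClosure.symmetric Step

≈W-trans : {x y z : List (Fin n)} → x ≈W y → y ≈W z → x ≈W z
≈W-trans = EqClosure.transitive Step

cancel-relator : (u v : List (Fin n)) {rel : List (Fin n)} → Relator rel →
                 (u ++ rel ++ v) ≈W (u ++ v)
cancel-relator u v r = EqClosure.return (del u v _ r)

insert-relator : (u v : List (Fin n)) {rel : List (Fin n)} → Relator rel →
                 (u ++ v) ≈W (u ++ rel ++ v)
insert-relator u v r = ≈W-sym (cancel-relator u v r)

step-++ˡ : (u : List (Fin n)) {x y : List (Fin n)} → Step x y → Step (u ++ x) (u ++ y)
step-++ˡ u (del u′ v rel r) =
  subst₂ Step (++-assoc u u′ (rel ++ v)) (++-assoc u u′ v) (del (u ++ u′) v rel r)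

step-++ʳ : (v : List (Fin n)) {x y : List (Fin n)} → Step x y → Step (x ++ v) (y ++ v)
step-++ʳ v (del u v′ rel r) =
  subst₂ Step
    (sym (trans (++-assoc u (rel ++ v′) v) (cong (u ++_) (++-assoc rel v′ v))))
    (sym (++-assoc u v′ v))
    (del u (v′ ++ v) rel r)

++-congˡ : (u : List (Fin n)) {x y : List (Fin n)} → x ≈W y → (u ++ x) ≈W (u ++ y)
++-congˡ u = EqClosure.gmap (u ++_) (step-++ˡ u)

++-congʳ : (v : List (Fin n)) {x y : List (Fin n)} → x ≈W y → (x ++ v) ≈W (y ++ v)
++-congʳ v = EqClosure.gmap (_++ v) (step-++ʳ v)

++-cong : {x x′ y y′ : List (Fin n)} → x ≈W x′ → y ≈W y′ → (x ++ y) ≈W (x′ ++ y′)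
++-cong {x′ = x′} {y = y} p q = ≈W-trans (++-congʳ y p) (++-congˡ x′ q)

reverse-cancelˡ : (w : List (Fin n)) → (reverse w ++ w) ≈W []
reverse-cancelˡ [] = ≈W-refl
reverse-cancelˡ (a ∷ w) = begin
  reverse (a ∷ w) ++ a ∷ w      ≡⟨ cong (_++ a ∷ w) (reverse-++ [ a ] w) ⟩
  (reverse w ++ [ a ]) ++ a ∷ w ≡⟨ ++-assoc (reverse w) [ a ] (a ∷ w) ⟩
  reverse w ++ a ∷ a ∷ w        ≈⟨ cancel-relator (reverse w) w (invol a) ⟩
  reverse w ++ w                ≈⟨ reverse-cancelˡ w ⟩
  []                            ∎
  where open ≈W-Reasoning

reverse-cancelʳ : (w : List (Fin n)) → (w ++ reverse w) ≈W []
reverse-cancelʳ w = begin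
  w ++ reverse w                   ≡⟨ cong (_++ reverse w) (reverse-involutive w) ⟨
  reverse (reverse w) ++ reverse w ≈⟨ reverse-cancelˡ (reverse w) ⟩
  []                               ∎
  where open ≈W-Reasoning

inverse-unique : (a b : List (Fin n)) → (a ++ b) ≈W [] → b ≈W reverse a
inverse-unique a b ab≈[] = begin
  b                      ≈⟨ ++-congʳ b (reverse-cancelˡ a) ⟨
  (reverse a ++ a) ++ b  ≡⟨ ++-assoc (reverse a) a b ⟩
  reverse a ++ (a ++ b)  ≈⟨ ++-congˡ (reverse a) ab≈[] ⟩
  reverse a ++ []        ≡⟨ ++-identityʳ (reverse a) ⟩
  reverse a              ∎
  where open ≈W-Reasoning

ι-++ : (x y : W⁺ m) → ι (x ++ y) ≡ ι x ++ ι y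
ι-++ = concatMap-++ ιL

inv-++ : (x y : W⁺ m) → inv (x ++ y) ≡ inv y ++ inv x
inv-++ x y = trans (cong reverse (map-++ _ x y)) (reverse-++ (map _ x) (map _ y))

ι-inv : (x : W⁺ m) → ι (inv x) ≡ reverse (ι x)
ι-inv [] = refl
ι-inv (ℓ ∷ x) = begin
  ι (inv ([ ℓ ] ++ x))              ≡⟨ cong ι (inv-++ [ ℓ ] x) ⟩
  ι (inv x ++ inv [ ℓ ])            ≡⟨ ι-++ (inv x) (inv [ ℓ ]) ⟩
  ι (inv x) ++ ι (inv [ ℓ ])        ≡⟨ cong₂ _++_ (ι-inv x) (ι-inv-letter ℓ) ⟩
  reverse (ι x) ++ reverse (ιL ℓ)   ≡⟨ reverse-++ (ιL ℓ) (ι x) ⟨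
  reverse (ιL ℓ ++ ι x)             ∎
  where
  open ≡-Reasoning
  ι-inv-letter : (ℓ : SLetter _) → ι (inv [ ℓ ]) ≡ reverse (ιL ℓ)
  ι-inv-letter (k , true)  = refl
  ι-inv-letter (k , false) = refl

conj₀ : List (Fin (suc m)) → List (Fin (suc m))
conj₀ w = (r₀ ∷ w) ++ [ r₀ ]

conj₀-[] : conj₀ {m} [] ≈W []
conj₀-[] = cancel-relator [] [] (invol r₀)

conj₀-cong : {u v : List (Fin (suc m))} → u ≈W v → conj₀ u ≈W conj₀ v
conj₀-cong u≈v = ++-congˡ [ r₀ ] (++-congʳ [ r₀ ] u≈v)

conj₀-++ : (u v : List (Fin (suc m))) → (conj₀ u ++ conj₀ v) ≈W conj₀ (u ++ v)
conj₀-++ u v = begin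
  conj₀ u ++ conj₀ v                  ≡⟨ ++-assoc (r₀ ∷ u) [ r₀ ] (conj₀ v) ⟩
  (r₀ ∷ u) ++ r₀ ∷ r₀ ∷ v ++ [ r₀ ]   ≈⟨ cancel-relator (r₀ ∷ u) (v ++ [ r₀ ]) (invol r₀) ⟩
  (r₀ ∷ u) ++ v ++ [ r₀ ]             ≡⟨ cong (r₀ ∷_) (++-assoc u v [ r₀ ]) ⟨
  conj₀ (u ++ v)                      ∎
  where open ≈W-Reasoning

conj₀-involutive : (w : List (Fin (suc m))) → conj₀ (conj₀ w) ≈W w
conj₀-involutive w = begin
  r₀ ∷ r₀ ∷ (w ++ [ r₀ ]) ++ [ r₀ ]   ≈⟨ cancel-relator [] _ (invol r₀) ⟩
  (w ++ [ r₀ ]) ++ [ r₀ ]             ≡⟨ ++-assoc w [ r₀ ] [ r₀ ] ⟩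
  w ++ r₀ ∷ r₀ ∷ []                   ≈⟨ cancel-relator w [] (invol r₀) ⟩
  w ++ []                             ≡⟨ ++-identityʳ w ⟩
  w                                   ∎
  where open ≈W-Reasoning

r₀-comm : (j : Fin m) (v : List (Fin (suc (suc m)))) →
          (r₀ ∷ suc (suc j) ∷ v) ≈W (suc (suc j) ∷ r₀ ∷ v)
r₀-comm j v = ≈W-sym (begin
  rⱼ ∷ r₀ ∷ v                         ≈⟨ insert-relator [] (rⱼ ∷ r₀ ∷ v) (comm r₀ rⱼ (s≤s (s≤s z≤n))) ⟩
  r₀ ∷ rⱼ ∷ r₀ ∷ rⱼ ∷ rⱼ ∷ r₀ ∷ v     ≈⟨ cancel-relator (r₀ ∷ rⱼ ∷ r₀ ∷ []) (r₀ ∷ v) (invol rⱼ) ⟩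
  r₀ ∷ rⱼ ∷ r₀ ∷ r₀ ∷ v               ≈⟨ cancel-relator (r₀ ∷ rⱼ ∷ []) v (invol r₀) ⟩
  r₀ ∷ rⱼ ∷ v                         ∎)
  where
  open ≈W-Reasoning
  rⱼ = suc (suc j)

-- r₀ s₁ r₀ = s₁⁻¹ ,  r₀ s₂ r₀ = s₁ s₁ s₂ ,  and r₀ commutes with s_j for j ≥ 3.
conj⁺-letter : SLetter m → W⁺ m
conj⁺-letter (zero , b)           = [ (zero , not b) ]
conj⁺-letter (suc zero , true)    = (zero , true) ∷ (zero , true) ∷ (suc zero , true) ∷ []
conj⁺-letter (suc zero , false)   = (suc zero , false) ∷ (zero , false) ∷ (zero , false) ∷ []
conj⁺-letter (suc (suc j) , b)    = [ (suc (suc j) , b) ]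

conj⁺ : W⁺ m → W⁺ m
conj⁺ = concatMap conj⁺-letter

conj⁺-++ : (x y : W⁺ m) → conj⁺ (x ++ y) ≡ conj⁺ x ++ conj⁺ y
conj⁺-++ = concatMap-++ conj⁺-letter

ι-conj⁺-letter : (ℓ : SLetter m) → ι (conj⁺-letter ℓ) ≈W conj₀ (ιL ℓ)
ι-conj⁺-letter (zero , true)  = insert-relator [] _ (invol r₀)
ι-conj⁺-letter (zero , false) = insert-relator (r₀ ∷ suc zero ∷ []) [] (invol r₀)
ι-conj⁺-letter (suc zero , true) =
  ≈W-trans (cancel-relator (r₀ ∷ suc zero ∷ r₀ ∷ []) _ (invol (suc zero)))
           (++-congˡ (r₀ ∷ suc zero ∷ []) (r₀-comm zero []))
ι-conj⁺-letter (suc zero , false) =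
  ≈W-trans (cancel-relator (suc (suc zero) ∷ []) _ (invol (suc zero)))
           (≈W-sym (r₀-comm zero _))
ι-conj⁺-letter (suc (suc j) , true) = ≈W-sym (begin
  r₀ ∷ rⱼ ∷ rⱼ₊₁ ∷ r₀ ∷ []   ≈⟨ r₀-comm _ _ ⟩
  rⱼ ∷ r₀ ∷ rⱼ₊₁ ∷ r₀ ∷ []   ≈⟨ ++-congˡ [ rⱼ ] (r₀-comm _ _) ⟩
  rⱼ ∷ rⱼ₊₁ ∷ r₀ ∷ r₀ ∷ []   ≈⟨ cancel-relator (rⱼ ∷ rⱼ₊₁ ∷ []) [] (invol r₀) ⟩
  rⱼ ∷ rⱼ₊₁ ∷ []             ∎)
  where
  open ≈W-Reasoning
  rⱼ = suc (suc (inject₁ j))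
  rⱼ₊₁ = suc (suc (suc j))
ι-conj⁺-letter (suc (suc j) , false) = ≈W-sym (begin
  r₀ ∷ rⱼ₊₁ ∷ rⱼ ∷ r₀ ∷ []   ≈⟨ r₀-comm _ _ ⟩
  rⱼ₊₁ ∷ r₀ ∷ rⱼ ∷ r₀ ∷ []   ≈⟨ ++-congˡ [ rⱼ₊₁ ] (r₀-comm _ _) ⟩
  rⱼ₊₁ ∷ rⱼ ∷ r₀ ∷ r₀ ∷ []   ≈⟨ cancel-relator (rⱼ₊₁ ∷ rⱼ ∷ []) [] (invol r₀) ⟩
  rⱼ₊₁ ∷ rⱼ ∷ []             ∎)
  where
  open ≈W-Reasoning
  rⱼ = suc (suc (inject₁ j))
  rⱼ₊₁ = suc (suc (suc j))

ι-conj⁺ : (x : W⁺ m) → ι (conj⁺ x) ≈W conj₀ (ι x)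
ι-conj⁺ [] = ≈W-sym conj₀-[]
ι-conj⁺ (ℓ ∷ x) = begin
  ι (conj⁺-letter ℓ ++ conj⁺ x)        ≡⟨ ι-++ (conj⁺-letter ℓ) (conj⁺ x) ⟩
  ι (conj⁺-letter ℓ) ++ ι (conj⁺ x)    ≈⟨ ++-cong (ι-conj⁺-letter ℓ) (ι-conj⁺ x) ⟩
  conj₀ (ιL ℓ) ++ conj₀ (ι x)          ≈⟨ conj₀-++ (ιL ℓ) (ι x) ⟩
  conj₀ (ιL ℓ ++ ι x)                  ∎
  where open ≈W-Reasoning

++-congˡ⁺ : (u : W⁺ m) {y y′ : W⁺ m} → y ≈⁺ y′ → (u ++ y) ≈⁺ (u ++ y′)
++-congˡ⁺ u {y} {y′} y≈y′ = begin
  ι (u ++ y)      ≡⟨ ι-++ u y ⟩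
  ι u ++ ι y      ≈⟨ ++-congˡ (ι u) y≈y′ ⟩
  ι u ++ ι y′     ≡⟨ ι-++ u y′ ⟨
  ι (u ++ y′)     ∎
  where open ≈W-Reasoning

++-congʳ⁺ : (v : W⁺ m) {x x′ : W⁺ m} → x ≈⁺ x′ → (x ++ v) ≈⁺ (x′ ++ v)
++-congʳ⁺ v {x} {x′} x≈x′ = begin
  ι (x ++ v)      ≡⟨ ι-++ x v ⟩
  ι x ++ ι v      ≈⟨ ++-congʳ (ι v) x≈x′ ⟩
  ι x′ ++ ι v     ≡⟨ ι-++ x′ v ⟨
  ι (x′ ++ v)     ∎
  where open ≈W-Reasoning

ι-inv-++ : (x y : W⁺ m) → ι (inv x ++ y) ≡ reverse (ι x) ++ ι y
ι-inv-++ x y = trans (ι-++ (inv x) y) (cong (_++ ι y) (ι-inv x))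

inv-cancelˡ : (x : W⁺ m) → (inv x ++ x) ≈⁺ []
inv-cancelˡ x = begin
  ι (inv x ++ x)          ≡⟨ ι-inv-++ x x ⟩
  reverse (ι x) ++ ι x    ≈⟨ reverse-cancelˡ (ι x) ⟩
  []                      ∎
  where open ≈W-Reasoning

conj⁺-involutive : (x : W⁺ m) → conj⁺ (conj⁺ x) ≈⁺ x
conj⁺-involutive x = begin
  ι (conj⁺ (conj⁺ x))   ≈⟨ ι-conj⁺ (conj⁺ x) ⟩
  conj₀ (ι (conj⁺ x))   ≈⟨ conj₀-cong (ι-conj⁺ x) ⟩
  conj₀ (conj₀ (ι x))   ≈⟨ conj₀-involutive (ι x) ⟩
  ι x                   ∎
  where open ≈W-Reasoning

conj⁺-inv : (x : W⁺ m) → conj⁺ (inv x) ≈⁺ inv (conj⁺ x)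
conj⁺-inv x = begin
  ι (conj⁺ (inv x))            ≈⟨ ι-conj⁺ (inv x) ⟩
  conj₀ (ι (inv x))            ≡⟨ cong conj₀ (ι-inv x) ⟩
  conj₀ (reverse (ι x))        ≈⟨ inverse-unique _ _ conj⁺x·conj₀x⁻¹≈ε ⟩
  reverse (ι (conj⁺ x))        ≡⟨ ι-inv (conj⁺ x) ⟨
  ι (inv (conj⁺ x))            ∎
  where
  open ≈W-Reasoning
  conj⁺x·conj₀x⁻¹≈ε : (ι (conj⁺ x) ++ conj₀ (reverse (ι x))) ≈W []
  conj⁺x·conj₀x⁻¹≈ε = begin
    ι (conj⁺ x) ++ conj₀ (reverse (ι x))    ≈⟨ ++-congʳ _ (ι-conj⁺ x) ⟩
    conj₀ (ι x) ++ conj₀ (reverse (ι x))    ≈⟨ conj₀-++ (ι x) (reverse (ι x)) ⟩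
    conj₀ (ι x ++ reverse (ι x))            ≈⟨ conj₀-cong (reverse-cancelʳ (ι x)) ⟩
    conj₀ []                                ≈⟨ conj₀-[] ⟩
    []                                      ∎

^r₀-resp : (M : Pred (W⁺ m) 0ℓ) {x y : W⁺ m} → x ≈⁺ y → (M ^r₀) x → (M ^r₀) y
^r₀-resp M x≈y (h , h∈M , x≈h^r₀) = h , h∈M , ≈W-trans (≈W-sym x≈y) x≈h^r₀

module _ {m : ℕ} {M : Pred (W⁺ m) 0ℓ} (M-normal : IsNormalSubgroup M) where
  open IsNormalSubgroup M-normal

  ∈^r₀⇔conj⁺∈ : (g : W⁺ m) → (M ^r₀) g ⇔ M (conj⁺ g)
  ∈^r₀⇔conj⁺∈ g = mk⇔ to from
    where
    open ≈W-Reasoning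
    to : (M ^r₀) g → M (conj⁺ g)
    to (h , h∈M , g≈h^r₀) = resp h≈conj⁺g h∈M
      where
      h≈conj⁺g : ι h ≈W ι (conj⁺ g)
      h≈conj⁺g = begin
        ι h                   ≈⟨ conj₀-involutive (ι h) ⟨
        conj₀ (conj₀ (ι h))   ≈⟨ conj₀-cong g≈h^r₀ ⟨
        conj₀ (ι g)           ≈⟨ ι-conj⁺ g ⟨
        ι (conj⁺ g)           ∎
    from : M (conj⁺ g) → (M ^r₀) g
    from conj⁺g∈M = conj⁺ g , conj⁺g∈M , (begin
      ι g                     ≈⟨ conj₀-involutive (ι g) ⟨
      conj₀ (conj₀ (ι g))     ≈⟨ conj₀-cong (ι-conj⁺ g) ⟨
      conj₀ (ι (conj⁺ g))     ∎)

  ∼-refl : (x : W⁺ m) → x ∼[ M ] x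
  ∼-refl x = resp (≈W-sym (inv-cancelˡ x)) ε-mem

  ∼-respʳ : {x y y′ : W⁺ m} → y ≈⁺ y′ → x ∼[ M ] y → x ∼[ M ] y′
  ∼-respʳ {x} y≈y′ = resp (++-congˡ⁺ (inv x) y≈y′)

  ++-∼ : {p : W⁺ m} (a : W⁺ m) → M p → (a ++ p) ∼[ M ] a
  ++-∼ {p} a p∈M = resp p⁻¹≈[ap]⁻¹·a (inv-mem p∈M)
    where
    open ≈⁺-Reasoning
    p⁻¹≈[ap]⁻¹·a : inv p ≈⁺ (inv (a ++ p) ++ a)
    p⁻¹≈[ap]⁻¹·a = begin
      inv p                     ≡⟨ ++-identityʳ (inv p) ⟨
      inv p ++ []               ≈⟨ ++-congˡ⁺ (inv p) (inv-cancelˡ a) ⟨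
      inv p ++ (inv a ++ a)     ≡⟨ ++-assoc (inv p) (inv a) a ⟨
      (inv p ++ inv a) ++ a     ≡⟨ cong (_++ a) (inv-++ a p) ⟨
      inv (a ++ p) ++ a         ∎

  ∼[^r₀]⇔∼-conj⁺ : (x y : W⁺ m) → x ∼[ M ^r₀ ] y ⇔ conj⁺ x ∼[ M ] conj⁺ y
  ∼[^r₀]⇔∼-conj⁺ x y = mk⇔
    (λ x∼y → resp conj⁺-x⁻¹y (Equivalence.to (∈^r₀⇔conj⁺∈ (inv x ++ y)) x∼y))
    (λ conj⁺x∼conj⁺y → Equivalence.from (∈^r₀⇔conj⁺∈ (inv x ++ y))
                         (resp (≈W-sym conj⁺-x⁻¹y) conj⁺x∼conj⁺y))
    where
    open ≈⁺-Reasoning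
    conj⁺-x⁻¹y : conj⁺ (inv x ++ y) ≈⁺ (inv (conj⁺ x) ++ conj⁺ y)
    conj⁺-x⁻¹y = begin
      conj⁺ (inv x ++ y)            ≡⟨ conj⁺-++ (inv x) y ⟩
      conj⁺ (inv x) ++ conj⁺ y      ≈⟨ ++-congʳ⁺ (conj⁺ y) {x = conj⁺ (inv x)} {inv (conj⁺ x)} (conj⁺-inv x) ⟩
      inv (conj⁺ x) ++ conj⁺ y      ∎

  ∼[core]⇔ : (x y : W⁺ m) → x ∼[ core M ] y ⇔ (x ∼[ M ] y × conj⁺ x ∼[ M ] conj⁺ y)
  ∼[core]⇔ x y = mk⇔ (map₂ to) (map₂ from)
    where open Equivalence (∼[^r₀]⇔∼-conj⁺ x y)

  chinese-remainder : TotallyChiral M → (a b : W⁺ m) → ∃ λ x → x ∼[ M ] a × conj⁺ x ∼[ M ] b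
  chinese-remainder totally-chiral a b with totally-chiral (inv a ++ conj⁺ b)
  ... | p , q , p∈M , q∈M^r₀ , a⁻¹·conj⁺b≈pq =
    a ++ p , ++-∼ a p∈M , conj⁺[ap]∼b
    where
    open ≈⁺-Reasoning
    q≈[ap]⁻¹·conj⁺b : q ≈⁺ (inv (a ++ p) ++ conj⁺ b)
    q≈[ap]⁻¹·conj⁺b = begin
      q                               ≈⟨ ++-congʳ⁺ q {x = inv p ++ p} {[]} (inv-cancelˡ p) ⟨
      (inv p ++ p) ++ q               ≡⟨ ++-assoc (inv p) p q ⟩
      inv p ++ (p ++ q)               ≈⟨ ++-congˡ⁺ (inv p) {y = inv a ++ conj⁺ b} {p ++ q} a⁻¹·conj⁺b≈pq ⟨
      inv p ++ (inv a ++ conj⁺ b)     ≡⟨ ++-assoc (inv p) (inv a) (conj⁺ b) ⟨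
      (inv p ++ inv a) ++ conj⁺ b     ≡⟨ cong (_++ conj⁺ b) (inv-++ a p) ⟨
      inv (a ++ p) ++ conj⁺ b         ∎
    a·p∼conj⁺b : (a ++ p) ∼[ M ^r₀ ] conj⁺ b
    a·p∼conj⁺b = ^r₀-resp M {q} {inv (a ++ p) ++ conj⁺ b} q≈[ap]⁻¹·conj⁺b q∈M^r₀
    conj⁺[ap]∼b : conj⁺ (a ++ p) ∼[ M ] b
    conj⁺[ap]∼b = ∼-respʳ {conj⁺ (a ++ p)} {conj⁺ (conj⁺ b)} {b} (conj⁺-involutive b)
                    (Equivalence.to (∼[^r₀]⇔∼-conj⁺ (a ++ p) (conj⁺ b)) a·p∼conj⁺b)

lemma4p2 : (m : ℕ) (M : Pred (W⁺ m) 0ℓ) →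
    IsChiralPolytopeGroup M → TotallyChiral M →
    QuotIso (core M) M M
lemma4p2 m M (M-normal , _ , _) totally-chiral = record
  { f₁         = id
  ; f₂         = conj⁺
  ; well-def   = λ x y → Equivalence.to (∼[core]⇔ M-normal x y)
  ; hom        = λ x y → ∼-refl M-normal (x ++ y)
                       , subst (conj⁺ (x ++ y) ∼[ M ]_) (conj⁺-++ x y)
                               (∼-refl M-normal (conj⁺ (x ++ y)))
  ; injective  = λ x y → Equivalence.from (∼[core]⇔ M-normal x y)
  ; surjective = chinese-remainder M-normal totally-chiral
  }
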